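{- For every finite simple graph $G$, \[ \mathrm{nucleus}(G)=\bigcap\bigl\{S\in\Omega(L_G):E(S,L^c(G))=\emptyset\bigr\} \] and \[ \mathrm{diadem}(G)=\bigcup\bigl\{S\in\Omega(L_G):E(S,L^c(G))=\emptyset\bigr\}\subseteq \mathrm{corona}(G)\cap L(G). \]
   Context: For $X\subseteq V(G)$, $N(X)$ is the union of neighborhoods of the vertices of $X$. $\Omega(H)$ is the family of maximum independent sets of a graph $H$; $\mathrm{corona}(G)=\bigcup\Omega(G)$. An independent set $I$ of $G$ is critical if $|I|-|N(I)|\ge |J|-|N(J)|$ for every independent set $J$ of $G$; a maximum critical independent set is a critical independent set of maximum cardinality among critical independent sets. $\mathrm{nucleus}(G)$ is the intersection of all maximum critical independent sets of $G$, and $\mathrm{diadem}(G)$ is the union of all critical independent sets of $G$. $L(G)$ denotes the set $J\cup N(J)$ for any maximum critical independent set $J$ of $G$ (this set does not depend on the choice of $J$); $L^c(G)=V(G)-L(G)$ and $L_G=G[L(G)]$. $E(X,Y)$ is the set of edges with one end in $X$ and the other in $Y$. -}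

module Defs where

open import Data.Nat using (ℕ; zero; suc; _≤_)
open import Data.Bool using (Bool; true; false; _∧_; _∨_)
open import Data.Fin using (Fin; zero; suc)
open import Data.Fin.Subset using (Subset; _∈_; _∉_; _⊆_; _∪_; ∣_∣)
open import Data.Vec using (lookup; tabulate)
open import Data.Integer using (ℤ; +_; _-_) renaming (_≤_ to _≤ℤ_)
open import Data.Product using (Σ; _×_; ∃)
open import Relation.Binary.PropositionalEquality using (_≡_)

record Graph (n : ℕ) : Set where
  field
    adj     : Fin n → Fin n → Bool
    symm    : ∀ x y → adj x y ≡ adj y x
    irrefl  : ∀ x → adj x x ≡ false
open Graph public

anyFin : ∀ {n} → (Fin n → Bool) → Bool
anyFin {zero}  f = false
anyFin {suc n} f = f zero ∨ anyFin (λ i → f (suc i))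

module _ {n : ℕ} (G : Graph n) where

  N : Subset n → Subset n
  N X = tabulate (λ v → anyFin (λ x → lookup X x ∧ adj G x v))

  Independent : Subset n → Set
  Independent I = ∀ x y → x ∈ I → y ∈ I → adj G x y ≡ false

  defect : Subset n → ℤ
  defect I = + ∣ I ∣ - + ∣ N I ∣

  Critical : Subset n → Set
  Critical I = Independent I × (∀ J → Independent J → defect J ≤ℤ defect I)

  MaxCritical : Subset n → Set
  MaxCritical I = Critical I × (∀ J → Critical J → ∣ J ∣ ≤ ∣ I ∣)

  MaxIndependent : Subset n → Set
  MaxIndependent S = Independent S × (∀ T → Independent T → ∣ T ∣ ≤ ∣ S ∣)

  corona : Fin n → Set
  corona v = Σ (Subset n) λ S → MaxIndependent S × v ∈ S

  nucleus : Fin n → Set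
  nucleus v = ∀ J → MaxCritical J → v ∈ J

  diadem : Fin n → Set
  diadem v = Σ (Subset n) λ I → Critical I × v ∈ I

  -- L(G) computed from a (maximum critical independent) set J: J ∪ N(J)
  LOf : Subset n → Subset n
  LOf J = J ∪ N J

  MaxIndependentIn : Subset n → Subset n → Set
  MaxIndependentIn L S =
    (S ⊆ L × Independent S) ×
    (∀ T → T ⊆ L → Independent T → ∣ T ∣ ≤ ∣ S ∣)

  NoEdgesToOutside : Subset n → Subset n → Set
  NoEdgesToOutside L S = ∀ x y → x ∈ S → y ∉ L → adj G x y ≡ false

  Family : Subset n → Subset n → Set
  Family L S = MaxIndependentIn L S × NoEdgesToOutside L S

  ⋂Family : Subset n → Fin n → Set
  ⋂Family L v = ∀ S → Family L S → v ∈ S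

  ⋃Family : Subset n → Fin n → Set
  ⋃Family L v = Σ (Subset n) λ S → Family L S × v ∈ S

{-# OPTIONS --safe #-}
-- The defect d(X) = |X| - |N(X)| is supermodular, so a critical set I satisfies
-- d(A) <= d(A ∪ I) for every independent A, and criticality of I yields Hall's condition
-- |J ∩ N(I)| <= |I ∩ N(J)|.  Hence for I critical and J maximum critical, (J - N(I)) ∪ I is
-- again maximum critical.  Fix J maximum critical and L = J ∪ N(J).  Every critical K lies
-- in L (otherwise that extension of J would be a larger critical set), and so does N(K):
-- otherwise Hall's condition forces d(J ∪ K) < d(J), against d(J) <= d(J ∪ K).  Hall's
-- condition also gives α(L_G) = |J|, and a maximum independent S of L_G with no edge leaving
-- L has |S| >= |J| and S ∪ N(S) ⊆ L, so d(S) >= d(J).  Thus the maximum critical sets are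
-- exactly the sets of the family, and as every critical set extends to a maximum critical
-- one, the union formula follows.  Extending a maximum independent set of G in the same way
-- puts every critical set inside corona(G).
module Submission where

open import Defs
open import Data.Bool using (Bool; true; false; _∧_; _∨_)
import Data.Bool.Properties as Bool
open import Data.Empty using (⊥; ⊥-elim)
open import Data.Fin using (Fin; zero; suc)
open import Data.Fin.Properties using (all?)
open import Data.Fin.Subset
  using (Subset; _∈_; _∉_; _⊆_; _⊂_; _∪_; _∩_; _─_; ∣_∣; inside; outside)
  renaming (⊥ to ∅)
open import Data.Fin.Subset.Properties
  using ( _∈?_; anySubset?; ∣p∣≤n; ∣⊥∣≡0; p⊆q⇒∣p∣≤∣q∣; p⊂q⇒∣p∣<∣q∣
        ; x∈p∪q⁺; x∈p∪q⁻; x∈p∩q⁺; x∈p∩q⁻; x∈p∧x∉q⇒x∈p─q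
        ; p⊆p∪q; q⊆p∪q; p∩q⊆p; p∩q⊆q; p─q⊆p )
open import Data.Integer using (+_; -_; _-_; _⊖_; 0ℤ)
  renaming (_+_ to _+ℤ_; _≤_ to _≤ℤ_; _<_ to _<ℤ_)
import Data.Integer.Properties as ℤ
open import Data.Integer.Tactic.RingSolver using (solve-∀)
open import Data.Nat using (ℕ; zero; suc; _+_; _≤_; _<_; z≤n; s≤s⁻¹; _≤?_)
import Data.Nat.Properties as ℕ
open import Data.Product using (∃; ∃-syntax; _×_; _,_; proj₁; proj₂)
open import Data.Sum using (_⊎_; inj₁; inj₂; [_,_]′)
import Data.Sum as Sum
open import Data.Vec using ([]; _∷_; here; there)
open import Data.Vec.Properties using ([]=⇒lookup; lookup⇒[]=; lookup∘tabulate)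
open import Function.Bundles using (_⇔_; mk⇔)
open import Relation.Binary.PropositionalEquality
  using (_≡_; refl; sym; trans; cong; cong₂; module ≡-Reasoning)
open import Relation.Nullary using (yes; no; contradiction)
open import Relation.Nullary.Decidable using (_×-dec_; _→-dec_)
open import Relation.Unary using (Decidable)

private
  variable
    n : ℕ

⊖-mono-≤ : ∀ {m m′ k k′} → m ≤ m′ → k′ ≤ k → m ⊖ k ≤ℤ m′ ⊖ k′
⊖-mono-≤ {m′ = m′} {k = k} m≤m′ k′≤k =
  ℤ.≤-trans (ℤ.⊖-monoˡ-≤ k m≤m′) (ℤ.⊖-monoʳ-≥-≤ m′ k′≤k)

+-cancelʳ-⊖ : ∀ m k o → (m + o) ⊖ (k + o) ≡ m ⊖ k
+-cancelʳ-⊖ m k o rewrite ℕ.+-comm m o | ℕ.+-comm k o = ℤ.+-cancelˡ-⊖ o m k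

⊖-+-⊖ : ∀ m k p q → (m ⊖ k) +ℤ (p ⊖ q) ≡ (m + p) ⊖ (k + q)
⊖-+-⊖ m k p q = begin
  (m ⊖ k) +ℤ (p ⊖ q)          ≡⟨ cong₂ _+ℤ_ (ℤ.[+m]-[+n]≡m⊖n m k) (ℤ.[+m]-[+n]≡m⊖n p q) ⟨
  (+ m - + k) +ℤ (+ p - + q)  ≡⟨ interchange (+ m) (+ k) (+ p) (+ q) ⟩
  (+ m +ℤ + p) - (+ k +ℤ + q) ≡⟨ cong₂ _-_ (ℤ.pos-+ m p) (ℤ.pos-+ k q) ⟨
  + (m + p) - + (k + q)       ≡⟨ ℤ.[+m]-[+n]≡m⊖n (m + p) (k + q) ⟩
  (m + p) ⊖ (k + q)           ∎
  where
  open ≡-Reasoning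
  interchange : ∀ a b c d → (a - b) +ℤ (c - d) ≡ (a +ℤ c) - (b +ℤ d)
  interchange = solve-∀

+-cancelʳ-≤ : ∀ {i j} k → i +ℤ k ≤ℤ j +ℤ k → i ≤ℤ j
+-cancelʳ-≤ {i} {j} k i+k≤j+k = begin
  i              ≡⟨ add-sub i k ⟨
  i +ℤ k - k     ≤⟨ ℤ.+-monoˡ-≤ (- k) i+k≤j+k ⟩
  j +ℤ k - k     ≡⟨ add-sub j k ⟩
  j              ∎
  where
  open ℤ.≤-Reasoning
  add-sub : ∀ a b → a +ℤ b - b ≡ a
  add-sub = solve-∀

m⊖k≤[m+p]⊖[k+q]⇒q≤p : ∀ {m k p q} → m ⊖ k ≤ℤ (m + p) ⊖ (k + q) → q ≤ p
m⊖k≤[m+p]⊖[k+q]⇒q≤p {m} {k} {p} {q} ineq =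
  ℤ.drop‿+≤+ (ℤ.0≤i-j⇒j≤i (ℤ.≤-trans 0≤p⊖q (ℤ.≤-reflexive (sym (ℤ.[+m]-[+n]≡m⊖n p q)))))
  where
  0≤p⊖q : 0ℤ ≤ℤ p ⊖ q
  0≤p⊖q = +-cancelʳ-≤ (m ⊖ k) (begin
    0ℤ +ℤ (m ⊖ k)       ≡⟨ ℤ.+-identityˡ (m ⊖ k) ⟩
    m ⊖ k               ≤⟨ ineq ⟩
    (m + p) ⊖ (k + q)   ≡⟨ ⊖-+-⊖ m k p q ⟨
    (m ⊖ k) +ℤ (p ⊖ q)  ≡⟨ ℤ.+-comm (m ⊖ k) (p ⊖ q) ⟩
    (p ⊖ q) +ℤ (m ⊖ k)  ∎)
    where open ℤ.≤-Reasoning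

∣p∪q∣+∣p∩q∣≡∣p∣+∣q∣ : ∀ (p q : Subset n) → ∣ p ∪ q ∣ + ∣ p ∩ q ∣ ≡ ∣ p ∣ + ∣ q ∣
∣p∪q∣+∣p∩q∣≡∣p∣+∣q∣ []            []            = refl
∣p∪q∣+∣p∩q∣≡∣p∣+∣q∣ (inside  ∷ p) (inside  ∷ q)
  rewrite ℕ.+-suc (∣ p ∪ q ∣) (∣ p ∩ q ∣) | ℕ.+-suc (∣ p ∣) (∣ q ∣) =
  cong (λ k → suc (suc k)) (∣p∪q∣+∣p∩q∣≡∣p∣+∣q∣ p q)
∣p∪q∣+∣p∩q∣≡∣p∣+∣q∣ (inside  ∷ p) (outside ∷ q) = cong suc (∣p∪q∣+∣p∩q∣≡∣p∣+∣q∣ p q)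
∣p∪q∣+∣p∩q∣≡∣p∣+∣q∣ (outside ∷ p) (inside  ∷ q) =
  trans (cong suc (∣p∪q∣+∣p∩q∣≡∣p∣+∣q∣ p q)) (sym (ℕ.+-suc (∣ p ∣) (∣ q ∣)))
∣p∪q∣+∣p∩q∣≡∣p∣+∣q∣ (outside ∷ p) (outside ∷ q) = ∣p∪q∣+∣p∩q∣≡∣p∣+∣q∣ p q

∣p─q∣+∣p∩q∣≡∣p∣ : ∀ (p q : Subset n) → ∣ p ─ q ∣ + ∣ p ∩ q ∣ ≡ ∣ p ∣
∣p─q∣+∣p∩q∣≡∣p∣ []            []            = refl
∣p─q∣+∣p∩q∣≡∣p∣ (inside  ∷ p) (inside  ∷ q) =
  trans (ℕ.+-suc (∣ p ─ q ∣) (∣ p ∩ q ∣)) (cong suc (∣p─q∣+∣p∩q∣≡∣p∣ p q))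
∣p─q∣+∣p∩q∣≡∣p∣ (inside  ∷ p) (outside ∷ q) = cong suc (∣p─q∣+∣p∩q∣≡∣p∣ p q)
∣p─q∣+∣p∩q∣≡∣p∣ (outside ∷ p) (inside  ∷ q) = ∣p─q∣+∣p∩q∣≡∣p∣ p q
∣p─q∣+∣p∩q∣≡∣p∣ (outside ∷ p) (outside ∷ q) = ∣p─q∣+∣p∩q∣≡∣p∣ p q

x∈p─q⇒x∉q : ∀ {x} (p q : Subset n) → x ∈ p ─ q → x ∉ q
x∈p─q⇒x∉q (inside ∷ p) (outside ∷ q) here          ()
x∈p─q⇒x∉q (_      ∷ p) (_       ∷ q) (there x∈p─q) (there x∈q) = x∈p─q⇒x∉q p q x∈p─q x∈q

p⊆q∪r⇒∣p∣≤∣q∣+∣r∣ : ∀ {p} (q r : Subset n) → p ⊆ q ∪ r → ∣ p ∣ ≤ ∣ q ∣ + ∣ r ∣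
p⊆q∪r⇒∣p∣≤∣q∣+∣r∣ {p = p} q r p⊆q∪r = begin
  ∣ p ∣                  ≤⟨ p⊆q⇒∣p∣≤∣q∣ p⊆q∪r ⟩
  ∣ q ∪ r ∣              ≤⟨ ℕ.m≤m+n (∣ q ∪ r ∣) (∣ q ∩ r ∣) ⟩
  ∣ q ∪ r ∣ + ∣ q ∩ r ∣  ≡⟨ ∣p∪q∣+∣p∩q∣≡∣p∣+∣q∣ q r ⟩
  ∣ q ∣ + ∣ r ∣          ∎
  where open ℕ.≤-Reasoning

q⊆p∪r⇒∣p∪q∣≤∣p∣+∣q∩r∣ : ∀ {p q r : Subset n} → q ⊆ p ∪ r → ∣ p ∪ q ∣ ≤ ∣ p ∣ + ∣ q ∩ r ∣
q⊆p∪r⇒∣p∪q∣≤∣p∣+∣q∩r∣ {p = p} {q} {r} q⊆p∪r = p⊆q∪r⇒∣p∣≤∣q∣+∣r∣ p (q ∩ r) λ x∈p∪q →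
  x∈p∪q⁺ (case (x∈p∪q⁻ p q x∈p∪q))
  where
  case : ∀ {x} → x ∈ p ⊎ x ∈ q → x ∈ p ⊎ x ∈ q ∩ r
  case (inj₁ x∈p) = inj₁ x∈p
  case (inj₂ x∈q) = Sum.map₂ (λ x∈r → x∈p∩q⁺ (x∈q , x∈r)) (x∈p∪q⁻ p r (q⊆p∪r x∈q))

disjoint⇒∣p∣+∣q∣≤∣r∣ : ∀ {p q r : Subset n} → p ⊆ r → q ⊆ r → (∀ {x} → x ∈ p → x ∉ q) →
                       ∣ p ∣ + ∣ q ∣ ≤ ∣ r ∣
disjoint⇒∣p∣+∣q∣≤∣r∣ {n} {p} {q} {r} p⊆r q⊆r p∩q≡∅ = begin
  ∣ p ∣ + ∣ q ∣          ≡⟨ ∣p∪q∣+∣p∩q∣≡∣p∣+∣q∣ p q ⟨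
  ∣ p ∪ q ∣ + ∣ p ∩ q ∣  ≤⟨ ℕ.+-mono-≤ (p⊆q⇒∣p∣≤∣q∣ p∪q⊆r) (p⊆q⇒∣p∣≤∣q∣ p∩q⊆∅) ⟩
  ∣ r ∣ + ∣ ∅ {n} ∣      ≡⟨ cong (λ k → ∣ r ∣ + k) (∣⊥∣≡0 n) ⟩
  ∣ r ∣ + 0              ≡⟨ ℕ.+-identityʳ ∣ r ∣ ⟩
  ∣ r ∣                  ∎
  where
  open ℕ.≤-Reasoning
  p∪q⊆r : p ∪ q ⊆ r
  p∪q⊆r x∈p∪q = [ p⊆r , q⊆r ]′ (x∈p∪q⁻ p q x∈p∪q)
  p∩q⊆∅ : p ∩ q ⊆ ∅
  p∩q⊆∅ x∈p∩q = let x∈p , x∈q = x∈p∩q⁻ p q x∈p∩q in ⊥-elim (p∩q≡∅ x∈p x∈q)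

maximum-exists : ∀ {P : Subset n → Set} → Decidable P → ∃ P →
                 ∃[ M ] P M × (∀ T → P T → ∣ T ∣ ≤ ∣ M ∣)
maximum-exists {n} {P} P? (S , PS) = search n (λ T _ → ∣p∣≤n T)
  where
  search : ∀ k → (∀ T → P T → ∣ T ∣ ≤ k) → ∃[ M ] P M × (∀ T → P T → ∣ T ∣ ≤ ∣ M ∣)
  search k bound with anySubset? (λ T → P? T ×-dec (k ≤? ∣ T ∣))
  search k       bound | yes (M , PM , k≤∣M∣) = M , PM , λ T PT → ℕ.≤-trans (bound T PT) k≤∣M∣
  search zero    _     | no none = ⊥-elim (none (S , PS , z≤n))
  search (suc k) _     | no none =
    search k (λ T PT → s≤s⁻¹ (ℕ.≰⇒> (λ k<∣T∣ → none (T , PT , k<∣T∣))))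

anyFin⁺ : ∀ {m} (f : Fin m → Bool) x → f x ≡ true → anyFin f ≡ true
anyFin⁺ f zero    fx≡true = cong (_∨ anyFin (λ i → f (suc i))) fx≡true
anyFin⁺ f (suc x) fx≡true =
  trans (cong (f zero ∨_) (anyFin⁺ (λ i → f (suc i)) x fx≡true)) (Bool.∨-zeroʳ (f zero))

anyFin⁻ : ∀ {m} (f : Fin m → Bool) → anyFin f ≡ true → ∃[ x ] f x ≡ true
anyFin⁻ {suc m} f any≡true with f zero in f0
... | true  = zero , f0
... | false = let x , fx = anyFin⁻ (λ i → f (suc i)) any≡true in suc x , fx

module _ (G : Graph n) where

  ∈N⁺ : ∀ {X x v} → x ∈ X → adj G x v ≡ true → v ∈ N G X
  ∈N⁺ {X} {x} {v} x∈X xv = lookup⇒[]= v (N G X)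
    (trans (lookup∘tabulate _ v) (anyFin⁺ _ x (trans (cong (_∧ adj G x v) ([]=⇒lookup x∈X)) xv)))

  ∈N⁻ : ∀ {X v} → v ∈ N G X → ∃[ x ] x ∈ X × adj G x v ≡ true
  ∈N⁻ {X} {v} v∈NX =
    let x , x∧xv = anyFin⁻ _ (trans (sym (lookup∘tabulate _ v)) ([]=⇒lookup v∈NX))
    in x , lookup⇒[]= x X (Bool.∧-conicalˡ _ _ x∧xv) , Bool.∧-conicalʳ _ _ x∧xv

  N-mono : ∀ {A B} → A ⊆ B → N G A ⊆ N G B
  N-mono A⊆B y∈NA = let x , x∈A , xy = ∈N⁻ y∈NA in ∈N⁺ (A⊆B x∈A) xy

  N-∪ : ∀ A B → N G (A ∪ B) ⊆ N G A ∪ N G B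
  N-∪ A B y∈N = let x , x∈A∪B , xy = ∈N⁻ y∈N in
    x∈p∪q⁺ (Sum.map (λ x∈A → ∈N⁺ x∈A xy) (λ x∈B → ∈N⁺ x∈B xy) (x∈p∪q⁻ A B x∈A∪B))

  ∉N-sym : ∀ {A B} → (∀ {x} → x ∈ A → x ∉ N G B) → ∀ {y} → y ∈ B → y ∉ N G A
  ∉N-sym A∩NB≡∅ y∈B y∈NA = let x , x∈A , xy = ∈N⁻ y∈NA in
    A∩NB≡∅ x∈A (∈N⁺ y∈B (trans (symm G _ _) xy))

  N-submodular : ∀ A B → ∣ N G (A ∪ B) ∣ + ∣ N G (A ∩ B) ∣ ≤ ∣ N G A ∣ + ∣ N G B ∣
  N-submodular A B = begin
    ∣ N G (A ∪ B) ∣ + ∣ N G (A ∩ B) ∣  ≤⟨ ℕ.+-mono-≤ (p⊆q⇒∣p∣≤∣q∣ (N-∪ A B)) (p⊆q⇒∣p∣≤∣q∣ N-∩) ⟩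
    ∣ N G A ∪ N G B ∣ + ∣ N G A ∩ N G B ∣  ≡⟨ ∣p∪q∣+∣p∩q∣≡∣p∣+∣q∣ (N G A) (N G B) ⟩
    ∣ N G A ∣ + ∣ N G B ∣                ∎
    where
    open ℕ.≤-Reasoning
    N-∩ : N G (A ∩ B) ⊆ N G A ∩ N G B
    N-∩ y∈N = x∈p∩q⁺ (N-mono (p∩q⊆p A B) y∈N , N-mono (p∩q⊆q A B) y∈N)

  ∣N[P─NQ]∣+∣Q∩NP∣≤∣NP∣ : ∀ P Q → ∣ N G (P ─ N G Q) ∣ + ∣ Q ∩ N G P ∣ ≤ ∣ N G P ∣
  ∣N[P─NQ]∣+∣Q∩NP∣≤∣NP∣ P Q = disjoint⇒∣p∣+∣q∣≤∣r∣ (N-mono (p─q⊆p P (N G Q))) (p∩q⊆q Q (N G P))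
    (λ y∈N[P─NQ] y∈Q∩NP →
      ∉N-sym (x∈p─q⇒x∉q P (N G Q)) (proj₁ (x∈p∩q⁻ Q (N G P) y∈Q∩NP)) y∈N[P─NQ])

  independent⇒∉N : ∀ {I} → Independent G I → ∀ {x} → x ∈ I → x ∉ N G I
  independent⇒∉N I-ind x∈I x∈NI = let y , y∈I , yx = ∈N⁻ x∈NI in
    contradiction (trans (sym yx) (I-ind _ _ y∈I x∈I)) λ ()

  ∉N⇒independent : ∀ {I} → (∀ {x} → x ∈ I → x ∉ N G I) → Independent G I
  ∉N⇒independent I∩NI≡∅ x y x∈I y∈I with adj G x y in xy
  ... | true  = contradiction (∈N⁺ x∈I xy) (I∩NI≡∅ y∈I)
  ... | false = refl

  independent-⊆ : ∀ {A B} → A ⊆ B → Independent G B → Independent G A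
  independent-⊆ A⊆B B-ind x y x∈A y∈A = B-ind x y (A⊆B x∈A) (A⊆B y∈A)

  independent-extension : ∀ {I M} → Independent G I → Independent G M →
                          Independent G ((M ─ N G I) ∪ I)
  independent-extension {I} {M} I-ind M-ind = ∉N⇒independent λ x∈X x∈NX →
    case (x∈p∪q⁻ (M ─ N G I) I x∈X) (x∈p∪q⁻ (N G (M ─ N G I)) (N G I) (N-∪ (M ─ N G I) I x∈NX))
    where
    M′⊆M : M ─ N G I ⊆ M
    M′⊆M = p─q⊆p M (N G I)
    case : ∀ {x} → x ∈ M ─ N G I ⊎ x ∈ I → x ∈ N G (M ─ N G I) ⊎ x ∈ N G I → ⊥
    case (inj₁ x∈M′) (inj₁ x∈NM′) = independent⇒∉N M-ind (M′⊆M x∈M′) (N-mono M′⊆M x∈NM′)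
    case (inj₁ x∈M′) (inj₂ x∈NI)  = x∈p─q⇒x∉q M (N G I) x∈M′ x∈NI
    case (inj₂ x∈I)  (inj₁ x∈NM′) = ∉N-sym (x∈p─q⇒x∉q M (N G I)) x∈I x∈NM′
    case (inj₂ x∈I)  (inj₂ x∈NI)  = independent⇒∉N I-ind x∈I x∈NI

  independent? : Decidable (Independent G)
  independent? I = all? λ x → all? λ y →
    (x ∈? I) →-dec ((y ∈? I) →-dec (adj G x y Bool.≟ false))

  defect-⊖ : ∀ A → defect G A ≡ ∣ A ∣ ⊖ ∣ N G A ∣
  defect-⊖ A = ℤ.[+m]-[+n]≡m⊖n (∣ A ∣) (∣ N G A ∣)

  defect-supermodular : ∀ A B →
    defect G A +ℤ defect G B ≤ℤ defect G (A ∪ B) +ℤ defect G (A ∩ B)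
  defect-supermodular A B = begin
    defect G A +ℤ defect G B
      ≡⟨ cong₂ _+ℤ_ (defect-⊖ A) (defect-⊖ B) ⟩
    (∣ A ∣ ⊖ ∣ N G A ∣) +ℤ (∣ B ∣ ⊖ ∣ N G B ∣)
      ≡⟨ ⊖-+-⊖ (∣ A ∣) (∣ N G A ∣) (∣ B ∣) (∣ N G B ∣) ⟩
    (∣ A ∣ + ∣ B ∣) ⊖ (∣ N G A ∣ + ∣ N G B ∣)
      ≤⟨ ⊖-mono-≤ (ℕ.≤-reflexive (sym (∣p∪q∣+∣p∩q∣≡∣p∣+∣q∣ A B))) (N-submodular A B) ⟩
    (∣ A ∪ B ∣ + ∣ A ∩ B ∣) ⊖ (∣ N G (A ∪ B) ∣ + ∣ N G (A ∩ B) ∣)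
      ≡⟨ ⊖-+-⊖ (∣ A ∪ B ∣) (∣ N G (A ∪ B) ∣) (∣ A ∩ B ∣) (∣ N G (A ∩ B) ∣) ⟨
    (∣ A ∪ B ∣ ⊖ ∣ N G (A ∪ B) ∣) +ℤ (∣ A ∩ B ∣ ⊖ ∣ N G (A ∩ B) ∣)
      ≡⟨ cong₂ _+ℤ_ (defect-⊖ (A ∪ B)) (defect-⊖ (A ∩ B)) ⟨
    defect G (A ∪ B) +ℤ defect G (A ∩ B)
      ∎
    where open ℤ.≤-Reasoning

  defect-≤-∪-critical : ∀ {I A} → Critical G I → Independent G A →
                        defect G A ≤ℤ defect G (A ∪ I)
  defect-≤-∪-critical {I} {A} (_ , I-max) A-ind = +-cancelʳ-≤ (defect G I) (begin
    defect G A +ℤ defect G I              ≤⟨ defect-supermodular A I ⟩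
    defect G (A ∪ I) +ℤ defect G (A ∩ I)  ≤⟨ ℤ.+-monoʳ-≤ (defect G (A ∪ I)) (I-max (A ∩ I) A∩I-ind) ⟩
    defect G (A ∪ I) +ℤ defect G I        ∎)
    where
    open ℤ.≤-Reasoning
    A∩I-ind : Independent G (A ∩ I)
    A∩I-ind = independent-⊆ (p∩q⊆p A I) A-ind

  critical-hall : ∀ {I} → Critical G I → ∀ J → ∣ J ∩ N G I ∣ ≤ ∣ I ∩ N G J ∣
  critical-hall {I} (I-ind , I-max) J =
    m⊖k≤[m+p]⊖[k+q]⇒q≤p {∣ I′ ∣} {∣ N G I′ ∣} {∣ I ∩ N G J ∣} {∣ J ∩ N G I ∣} (begin
    ∣ I′ ∣ ⊖ ∣ N G I′ ∣
      ≡⟨ defect-⊖ I′ ⟨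
    defect G I′
      ≤⟨ I-max I′ (independent-⊆ (p─q⊆p I (N G J)) I-ind) ⟩
    defect G I
      ≡⟨ defect-⊖ I ⟩
    ∣ I ∣ ⊖ ∣ N G I ∣
      ≤⟨ ⊖-mono-≤ (ℕ.≤-reflexive (sym (∣p─q∣+∣p∩q∣≡∣p∣ I (N G J)))) (∣N[P─NQ]∣+∣Q∩NP∣≤∣NP∣ I J) ⟩
    (∣ I′ ∣ + ∣ I ∩ N G J ∣) ⊖ (∣ N G I′ ∣ + ∣ J ∩ N G I ∣)
      ∎)
    where
    open ℤ.≤-Reasoning
    I′ : Subset n
    I′ = I ─ N G J

  critical⇒∣J∣≤∣J─NI∣+∣I∩NJ∣ : ∀ {I} → Critical G I → ∀ J → ∣ J ∣ ≤ ∣ J ─ N G I ∣ + ∣ I ∩ N G J ∣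
  critical⇒∣J∣≤∣J─NI∣+∣I∩NJ∣ {I} I-crit J = begin
    ∣ J ∣                          ≡⟨ ∣p─q∣+∣p∩q∣≡∣p∣ J (N G I) ⟨
    ∣ J ─ N G I ∣ + ∣ J ∩ N G I ∣  ≤⟨ ℕ.+-monoʳ-≤ ∣ J ─ N G I ∣ (critical-hall I-crit J) ⟩
    ∣ J ─ N G I ∣ + ∣ I ∩ N G J ∣  ∎
    where open ℕ.≤-Reasoning

  defect-≤-─N : ∀ {I} → Critical G I → ∀ J → defect G J ≤ℤ defect G (J ─ N G I)
  defect-≤-─N {I} I-crit J = begin
    defect G J
      ≡⟨ defect-⊖ J ⟩
    ∣ J ∣ ⊖ ∣ N G J ∣
      ≤⟨ ⊖-mono-≤ (critical⇒∣J∣≤∣J─NI∣+∣I∩NJ∣ I-crit J) (∣N[P─NQ]∣+∣Q∩NP∣≤∣NP∣ J I) ⟩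
    (∣ J′ ∣ + ∣ I ∩ N G J ∣) ⊖ (∣ N G J′ ∣ + ∣ I ∩ N G J ∣)
      ≡⟨ +-cancelʳ-⊖ (∣ J′ ∣) (∣ N G J′ ∣) (∣ I ∩ N G J ∣) ⟩
    ∣ J′ ∣ ⊖ ∣ N G J′ ∣
      ≡⟨ defect-⊖ J′ ⟨
    defect G J′
      ∎
    where
    open ℤ.≤-Reasoning
    J′ : Subset n
    J′ = J ─ N G I

  ∣J∣≤∣[J─NI]∪I∣ : ∀ {I J} → Critical G I → Independent G J → ∣ J ∣ ≤ ∣ (J ─ N G I) ∪ I ∣
  ∣J∣≤∣[J─NI]∪I∣ {I} {J} I-crit J-ind = ℕ.≤-trans (critical⇒∣J∣≤∣J─NI∣+∣I∩NJ∣ I-crit J)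
    (disjoint⇒∣p∣+∣q∣≤∣r∣ (p⊆p∪q I) (λ x∈I∩NJ → q⊆p∪q (J ─ N G I) I (p∩q⊆p I (N G J) x∈I∩NJ))
      (λ x∈J─NI x∈I∩NJ →
        independent⇒∉N J-ind (p─q⊆p J (N G I) x∈J─NI) (p∩q⊆q I (N G J) x∈I∩NJ)))

  critical-extension : ∀ {I J} → Critical G I → Critical G J → Critical G ((J ─ N G I) ∪ I)
  critical-extension {I} {J} I-crit (J-ind , J-max) =
    independent-extension (proj₁ I-crit) J-ind , λ K K-ind → begin
      defect G K                   ≤⟨ J-max K K-ind ⟩
      defect G J                   ≤⟨ defect-≤-─N I-crit J ⟩
      defect G (J ─ N G I)         ≤⟨ defect-≤-∪-critical I-crit (independent-⊆ (p─q⊆p J (N G I)) J-ind) ⟩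
      defect G ((J ─ N G I) ∪ I)   ∎
    where open ℤ.≤-Reasoning

  maxCritical-extension : ∀ {I J} → Critical G I → MaxCritical G J →
                          MaxCritical G ((J ─ N G I) ∪ I)
  maxCritical-extension I-crit (J-crit , J-max) =
    critical-extension I-crit J-crit ,
    λ K K-crit → ℕ.≤-trans (J-max K K-crit) (∣J∣≤∣[J─NI]∪I∣ I-crit (proj₁ J-crit))

  critical⇒corona : ∀ {S v} → Critical G S → v ∈ S → corona G v
  critical⇒corona {S} S-crit@(S-ind , _) v∈S =
    let M , M-ind , M-max = maximum-exists independent? (S , S-ind)
    in (M ─ N G S) ∪ S ,
       (independent-extension S-ind M-ind ,
        λ T T-ind → ℕ.≤-trans (M-max T T-ind) (∣J∣≤∣[J─NI]∪I∣ S-crit M-ind)) ,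
       q⊆p∪q (M ─ N G S) S v∈S

  ∣NJ∣+∣K∩NJ∣<∣N[J∪K]∣ : ∀ {J K y} → Critical G J → y ∈ N G K → y ∉ J ∪ N G J →
                          ∣ N G J ∣ + ∣ K ∩ N G J ∣ < ∣ N G (J ∪ K) ∣
  ∣NJ∣+∣K∩NJ∣<∣N[J∪K]∣ {J} {K} {y} J-crit@(J-ind , _) y∈NK y∉L = begin-strict
    ∣ N G J ∣ + ∣ K ∩ N G J ∣  ≤⟨ ℕ.+-monoʳ-≤ ∣ N G J ∣ (critical-hall J-crit K) ⟩
    ∣ N G J ∣ + ∣ J ∩ N G K ∣  ≤⟨ disjoint⇒∣p∣+∣q∣≤∣r∣ (p⊆p∪q (J ∩ N G K)) (q⊆p∪q (N G J) (J ∩ N G K))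
                                    (λ x∈NJ x∈J∩NK → independent⇒∉N J-ind (p∩q⊆p J (N G K) x∈J∩NK) x∈NJ) ⟩
    ∣ W ∣                      <⟨ p⊂q⇒∣p∣<∣q∣ W⊂N[J∪K] ⟩
    ∣ N G (J ∪ K) ∣            ∎
    where
    open ℕ.≤-Reasoning
    W : Subset n
    W = N G J ∪ (J ∩ N G K)
    W⊆N[J∪K] : W ⊆ N G (J ∪ K)
    W⊆N[J∪K] x∈W with x∈p∪q⁻ (N G J) (J ∩ N G K) x∈W
    ... | inj₁ x∈NJ   = N-mono {A = J} (p⊆p∪q K) x∈NJ
    ... | inj₂ x∈J∩NK = N-mono (q⊆p∪q J K) (p∩q⊆q J (N G K) x∈J∩NK)
    y∉W : y ∉ W
    y∉W y∈W with x∈p∪q⁻ (N G J) (J ∩ N G K) y∈W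
    ... | inj₁ y∈NJ   = y∉L (x∈p∪q⁺ (inj₂ y∈NJ))
    ... | inj₂ y∈J∩NK = y∉L (x∈p∪q⁺ (inj₁ (p∩q⊆p J (N G K) y∈J∩NK)))
    W⊂N[J∪K] : W ⊂ N G (J ∪ K)
    W⊂N[J∪K] = W⊆N[J∪K] , y , N-mono (q⊆p∪q J K) y∈NK , y∉W

  defect-∪-< : ∀ {J K y} → Critical G J → K ⊆ J ∪ N G J → y ∈ N G K → y ∉ J ∪ N G J →
               defect G (J ∪ K) <ℤ defect G J
  defect-∪-< {J} {K} J-crit K⊆L y∈NK y∉L = begin-strict
    defect G (J ∪ K)
      ≡⟨ defect-⊖ (J ∪ K) ⟩
    ∣ J ∪ K ∣ ⊖ ∣ N G (J ∪ K) ∣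
      ≤⟨ ⊖-mono-≤ (q⊆p∪r⇒∣p∪q∣≤∣p∣+∣q∩r∣ K⊆L) (∣NJ∣+∣K∩NJ∣<∣N[J∪K]∣ J-crit y∈NK y∉L) ⟩
    (∣ J ∣ + ∣ K ∩ N G J ∣) ⊖ (suc ∣ N G J ∣ + ∣ K ∩ N G J ∣)
      ≡⟨ +-cancelʳ-⊖ (∣ J ∣) (suc ∣ N G J ∣) (∣ K ∩ N G J ∣) ⟩
    ∣ J ∣ ⊖ suc ∣ N G J ∣
      <⟨ ℤ.⊖-monoʳ->-< ∣ J ∣ (ℕ.n<1+n ∣ N G J ∣) ⟩
    ∣ J ∣ ⊖ ∣ N G J ∣
      ≡⟨ defect-⊖ J ⟨
    defect G J
      ∎
    where open ℤ.≤-Reasoning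

  module _ {J : Subset n} (J-maxCrit : MaxCritical G J) where

    private
      J-crit : Critical G J
      J-crit = proj₁ J-maxCrit

    critical⊆L : ∀ {I} → Critical G I → I ⊆ LOf G J
    critical⊆L {I} I-crit {x} x∈I with x ∈? LOf G J
    ... | yes x∈L = x∈L
    ... | no  x∉L = contradiction
      (proj₂ J-maxCrit ((I ─ N G J) ∪ J) (critical-extension J-crit I-crit))
      (ℕ.<⇒≱ (p⊂q⇒∣p∣<∣q∣ J⊂X))
      where
      J⊂X : J ⊂ (I ─ N G J) ∪ J
      J⊂X = q⊆p∪q (I ─ N G J) J ,
            x , p⊆p∪q J (x∈p∧x∉q⇒x∈p─q x∈I (λ x∈NJ → x∉L (x∈p∪q⁺ (inj₂ x∈NJ)))) ,
            λ x∈J → x∉L (x∈p∪q⁺ (inj₁ x∈J))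

    N-critical⊆L : ∀ {K} → Critical G K → N G K ⊆ LOf G J
    N-critical⊆L {K} K-crit {y} y∈NK with y ∈? LOf G J
    ... | yes y∈L = y∈L
    ... | no  y∉L = contradiction (defect-≤-∪-critical K-crit (proj₁ J-crit))
                      (ℤ.<⇒≱ (defect-∪-< J-crit (critical⊆L K-crit) y∈NK y∉L))

    independent⊆L⇒∣T∣≤∣J∣ : ∀ {T} → T ⊆ LOf G J → Independent G T → ∣ T ∣ ≤ ∣ J ∣
    independent⊆L⇒∣T∣≤∣J∣ {T} T⊆L T-ind = begin
      ∣ T ∣                          ≡⟨ ∣p─q∣+∣p∩q∣≡∣p∣ T (N G J) ⟨
      ∣ T ─ N G J ∣ + ∣ T ∩ N G J ∣  ≤⟨ ℕ.+-monoʳ-≤ ∣ T ─ N G J ∣ (critical-hall J-crit T) ⟩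
      ∣ T ─ N G J ∣ + ∣ J ∩ N G T ∣  ≤⟨ disjoint⇒∣p∣+∣q∣≤∣r∣ T─NJ⊆J (p∩q⊆p J (N G T))
                                          (λ x∈T─NJ x∈J∩NT → independent⇒∉N T-ind
                                             (p─q⊆p T (N G J) x∈T─NJ) (p∩q⊆q J (N G T) x∈J∩NT)) ⟩
      ∣ J ∣                          ∎
      where
      open ℕ.≤-Reasoning
      T─NJ⊆J : T ─ N G J ⊆ J
      T─NJ⊆J x∈T─NJ with x∈p∪q⁻ J (N G J) (T⊆L (p─q⊆p T (N G J) x∈T─NJ))
      ... | inj₁ x∈J  = x∈J
      ... | inj₂ x∈NJ = contradiction x∈NJ (x∈p─q⇒x∉q T (N G J) x∈T─NJ)

    maxCritical⇒family : ∀ {K} → MaxCritical G K → Family G (LOf G J) K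
    maxCritical⇒family {K} (K-crit@(K-ind , _) , K-max) =
      ((critical⊆L K-crit , K-ind) ,
       λ T T⊆L T-ind → ℕ.≤-trans (independent⊆L⇒∣T∣≤∣J∣ T⊆L T-ind) (K-max J J-crit)) ,
      no-edge
      where
      no-edge : NoEdgesToOutside G (LOf G J) K
      no-edge x y x∈K y∉L with adj G x y in xy
      ... | true  = contradiction (N-critical⊆L K-crit (∈N⁺ x∈K xy)) y∉L
      ... | false = refl

    family⇒maxCritical : ∀ {S} → Family G (LOf G J) S → MaxCritical G S
    family⇒maxCritical {S} (((S⊆L , S-ind) , S-max) , no-edge) =
      (S-ind , λ K K-ind → ℤ.≤-trans (proj₂ J-crit K K-ind) defect-J≤defect-S) ,
      λ K K-crit → ℕ.≤-trans (proj₂ J-maxCrit K K-crit) ∣J∣≤∣S∣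
      where
      ∣J∣≤∣S∣ : ∣ J ∣ ≤ ∣ S ∣
      ∣J∣≤∣S∣ = S-max J (p⊆p∪q (N G J)) (proj₁ J-crit)

      NS⊆L : N G S ⊆ LOf G J
      NS⊆L {y} y∈NS with y ∈? LOf G J
      ... | yes y∈L = y∈L
      ... | no  y∉L = let x , x∈S , xy = ∈N⁻ y∈NS in
        contradiction (trans (sym xy) (no-edge x y x∈S y∉L)) λ ()

      ∣S∣+∣NS∣≤∣J∣+∣NJ∣ : ∣ S ∣ + ∣ N G S ∣ ≤ ∣ J ∣ + ∣ N G J ∣
      ∣S∣+∣NS∣≤∣J∣+∣NJ∣ = ℕ.≤-trans (disjoint⇒∣p∣+∣q∣≤∣r∣ S⊆L NS⊆L (independent⇒∉N S-ind))
                                     (p⊆q∪r⇒∣p∣≤∣q∣+∣r∣ J (N G J) λ x∈L → x∈L)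

      defect-J≤defect-S : defect G J ≤ℤ defect G S
      defect-J≤defect-S = begin
        defect G J                              ≡⟨ defect-⊖ J ⟩
        ∣ J ∣ ⊖ ∣ N G J ∣                       ≡⟨ ℤ.+-cancelˡ-⊖ (∣ J ∣) (∣ J ∣) (∣ N G J ∣) ⟨
        (∣ J ∣ + ∣ J ∣) ⊖ (∣ J ∣ + ∣ N G J ∣)   ≤⟨ ⊖-mono-≤ (ℕ.+-mono-≤ ∣J∣≤∣S∣ ∣J∣≤∣S∣) ∣S∣+∣NS∣≤∣J∣+∣NJ∣ ⟩
        (∣ S ∣ + ∣ S ∣) ⊖ (∣ S ∣ + ∣ N G S ∣)   ≡⟨ ℤ.+-cancelˡ-⊖ (∣ S ∣) (∣ S ∣) (∣ N G S ∣) ⟩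
        ∣ S ∣ ⊖ ∣ N G S ∣                       ≡⟨ defect-⊖ S ⟨
        defect G S                              ∎
        where open ℤ.≤-Reasoning

mainTheorem4 : ∀ {n : ℕ} (G : Graph n) (J : Subset n) → MaxCritical G J →
    ((∀ v → nucleus G v ⇔ ⋂Family G (LOf G J) v) ×
     (∀ v → diadem G v ⇔ ⋃Family G (LOf G J) v)) ×
    (∀ v → ⋃Family G (LOf G J) v → corona G v × v ∈ LOf G J)
mainTheorem4 G J J-maxCrit =
  ( (λ v → mk⇔ (λ v∈nucleus S S∈F → v∈nucleus S (family⇒maxCritical G J-maxCrit S∈F))
               (λ v∈⋂F K K-maxCrit → v∈⋂F K (maxCritical⇒family G J-maxCrit K-maxCrit)))
  , (λ v → mk⇔ (λ { (I , I-crit , v∈I) →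
                      (J ─ N G I) ∪ I ,
                      maxCritical⇒family G J-maxCrit (maxCritical-extension G I-crit J-maxCrit) ,
                      q⊆p∪q (J ─ N G I) I v∈I })
               (λ { (S , S∈F , v∈S) → S , proj₁ (family⇒maxCritical G J-maxCrit S∈F) , v∈S })) )
  , λ { v (S , S∈F@(((S⊆L , _) , _) , _) , v∈S) →
          critical⇒corona G (proj₁ (family⇒maxCritical G J-maxCrit S∈F)) v∈S , S⊆L v∈S }
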